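{- Let $G$ be a simple connected graph of order $n\geq 3$ with minimum degree $\delta(G)\geq 2$. Let $X\subseteq V(G)$ be a differential set of $G$ and let $Y\subseteq V(R(G))$ be a differential set of $R(G)$. Then $|Y|\geq |X|$.
   Context: $R(G)$ is the graph obtained from $G$ by adding, for each edge $e=xy\in E(G)$, a new vertex $v_e$ adjacent exactly to $x$ and $y$. For a graph $H$ and $S\subseteq V(H)$, $B_H(S)$ is the set of vertices not in $S$ adjacent to some vertex of $S$, $\partial_H(S)=|B_H(S)|-|S|$, $\partial(H)=\max_{S\subseteq V(H)}\partial_H(S)$, and $S$ is a differential set of $H$ if $\partial_H(S)=\partial(H)$. -}

module Defs where

open import Data.Nat using (ℕ; zero; suc; _≤_; _<ᵇ_)
open import Data.Integer using (ℤ; +_; _-_) renaming (_≤_ to _≤ℤ_)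
open import Data.Bool using (Bool; true; false; _∧_; not)
open import Data.Fin using (Fin; toℕ; splitAt)
open import Data.Fin.Subset using (Subset; ∣_∣)
open import Data.Vec using (lookup; tabulate)
open import Data.Bool.ListAction using (any)
open import Data.List using (List; length; filterᵇ; cartesianProduct; allFin)
import Data.List as L
open import Data.Product using (_×_; _,_; proj₁; proj₂)
open import Data.Sum using (inj₁; inj₂)
open import Relation.Binary.PropositionalEquality using (_≡_)
import Data.Nat

_==_ : ∀ {n} → Fin n → Fin n → Bool
i == j = toℕ i Data.Nat.≡ᵇ toℕ j

record SimpleGraph (n : ℕ) : Set where
  field
    adj    : Fin n → Fin n → Bool
    sym    : ∀ i j → adj i j ≡ adj j i
    irrefl : ∀ i → adj i i ≡ false
open SimpleGraph public

data Reachable {n : ℕ} (G : SimpleGraph n) : Fin n → Fin n → Set where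
  here : ∀ {u} → Reachable G u u
  step : ∀ {u v w} → adj G u v ≡ true → Reachable G v w → Reachable G u w

Connected : ∀ {n} → SimpleGraph n → Set
Connected G = ∀ u v → Reachable G u v

degree : ∀ {n} → SimpleGraph n → Fin n → ℕ
degree {n} G u = length (filterᵇ (adj G u) (allFin n))

MinDegreeAtLeast : ∀ {n} → ℕ → SimpleGraph n → Set
MinDegreeAtLeast k G = ∀ u → k ≤ degree G u

inS : ∀ {N} → Subset N → Fin N → Bool
inS S v = lookup S v

boundary : ∀ {N} → (Fin N → Fin N → Bool) → Subset N → Subset N
boundary {N} a S =
  tabulate (λ v → not (inS S v) ∧ any (λ u → inS S u ∧ a u v) (allFin N))

∂ : ∀ {N} → (Fin N → Fin N → Bool) → Subset N → ℤ
∂ a S = + ∣ boundary a S ∣ - + ∣ S ∣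

IsDifferentialSet : ∀ {N} → (Fin N → Fin N → Bool) → Subset N → Set
IsDifferentialSet {N} a S = ∀ (T : Subset N) → ∂ a T ≤ℤ ∂ a S

edges : ∀ {n} → SimpleGraph n → List (Fin n × Fin n)
edges {n} G = filterᵇ (λ p → (toℕ (proj₁ p) <ᵇ toℕ (proj₂ p)) ∧ adj G (proj₁ p) (proj₂ p))
                      (cartesianProduct (allFin n) (allFin n))

orderR : ∀ {n} → SimpleGraph n → ℕ
orderR {n} G = n Data.Nat.+ length (edges G)

-- adjacency of R(G): vertices Fin n ⊎ (edges), joined into Fin (n + m);
-- original vertices keep G's adjacency, edge vertex v_e (e = xy) is
-- adjacent exactly to x and y, edge vertices are pairwise non-adjacent.
adjR : ∀ {n} (G : SimpleGraph n) → Fin (orderR G) → Fin (orderR G) → Bool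
adjR {n} G u v with splitAt n u | splitAt n v
... | inj₁ x | inj₁ y = adj G x y
... | inj₁ x | inj₂ e = (x == proj₁ (L.lookup (edges G) e)) Data.Bool.∨ (x == proj₂ (L.lookup (edges G) e))
... | inj₂ e | inj₁ y = (y == proj₁ (L.lookup (edges G) e)) Data.Bool.∨ (y == proj₂ (L.lookup (edges G) e))
... | inj₂ _ | inj₂ _ = false

-- Split a differential set Y of R(G) into its original vertices D and its edge vertices E.
-- Maximality of Y forces every vertex w of G to lie in D, in the boundary of D in G, or on an
-- edge of E: otherwise w and the edge vertices of two of its edges are all undominated by Y,
-- and adding w to Y would gain those two edge vertices for the boundary at the cost of one
-- vertex. Hence |V(G)| ≤ |D| + |B(D)| + 2|E|, and comparing ∂(D) ≤ ∂(X) with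
-- |B(X)| + |X| ≤ |V(G)| gives 2|X| ≤ 2|D| + 2|E| = 2|Y|.
module Submission where

open import Defs hiding (sym)
open import Data.Nat using (ℕ; _≤_)
open import Data.Fin.Subset using (Subset; ∣_∣)

open import Data.Bool using (Bool; true; false; _∧_; not; T)
open import Data.Bool.ListAction using (any)
open import Data.Bool.Properties using (T-≡; T-∧; T-∨; ¬-not)
open import Data.Empty using (⊥; ⊥-elim)
open import Data.Fin using (Fin; zero; suc; toℕ; _↑ˡ_; _↑ʳ_; splitAt)
open import Data.Fin.Properties
  using (toℕ-injective; ↑ʳ-injective; splitAt-↑ˡ; splitAt-↑ʳ; splitAt⁻¹-↑ˡ; splitAt⁻¹-↑ʳ)
open import Data.Fin.Subset
  using (_∈_; _∉_; _⊆_; _∪_; ⁅_⁆; ∁; ⊤) renaming (⊥ to ∅)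
open import Data.Fin.Subset.Properties
  using (x∈p∪q⁺; x∈p∪q⁻; p⊆p∪q; x∈⁅x⁆; x∈⁅y⁆⇒x≡y; x∈⁅y⁆⇔x≡y; ∪-comm; x∉p⇒x∈∁p; p⊆q⇒∣p∣≤∣q∣;
         p⊂q⇒∣p∣<∣q∣; ∣p∣≤n; ∣∁p∣≡n∸∣p∣; ∣⊥∣≡0; ∣⊤∣≡n; ∣⁅x⁆∣≡1; _∈?_)
open import Data.Integer as ℤ using () renaming (_≤_ to _≤ℤ_)
import Data.Integer.Properties as ℤ
import Data.Integer.Tactic.RingSolver as ℤ
open import Data.List using (List; []; _∷_; length; filterᵇ; allFin)
import Data.List as List
import Data.List.Membership.Propositional as List
open import Data.List.Membership.Propositional.Properties
  using (∈-allFin; ∈-filter⁺; ∈-filter⁻; ∈-cartesianProduct⁺)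
open import Data.List.Relation.Unary.Any using (here; there; index; satisfied)
open import Data.List.Relation.Unary.Any.Properties using (any⁺; any⁻; tabulate⁺; lookup-index)
open import Data.List.Relation.Unary.All using (_∷_)
open import Data.List.Relation.Unary.AllPairs using (_∷_)
open import Data.List.Relation.Unary.Unique.Propositional using (Unique)
import Data.List.Relation.Unary.Unique.Propositional.Properties as Unique
open import Data.Nat using (suc; _+_; _*_; _∸_; _<_; z≤n; s≤s)
open import Data.Nat.Properties
import Data.Nat.Tactic.RingSolver as ℕ
open import Data.Product using (_×_; _,_; proj₁; proj₂; ∃; ∃₂)
open import Data.Sum using (inj₁; inj₂)
import Data.Sum as Sum
open import Data.Vec using ([]; _∷_; _++_; lookup; here; there)
import Data.Vec as Vec
open import Data.Vec.Properties using (lookup∘tabulate; lookup⇒[]=; []=⇒lookup; lookup-++ˡ; lookup-++ʳ)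
open import Function using (_∘_; _⇔_; mk⇔; Equivalence)
open import Relation.Binary.Definitions using (tri<; tri≈; tri>)
open import Relation.Binary.PropositionalEquality
open import Relation.Nullary using (yes; no)
open import Relation.Nullary.Decidable using (T?)

open Equivalence using (to; from)

private variable
  M N k : ℕ
  a : Fin N → Fin N → Bool
  S X : Subset N
  u v w x : Fin N

∣p∪q∣≤∣p∣+∣q∣ : (p q : Subset N) → ∣ p ∪ q ∣ ≤ ∣ p ∣ + ∣ q ∣
∣p∪q∣≤∣p∣+∣q∣ []          []          = z≤n
∣p∪q∣≤∣p∣+∣q∣ (true ∷ p)  (true ∷ q)  = s≤s (≤-trans (∣p∪q∣≤∣p∣+∣q∣ p q) (+-monoʳ-≤ ∣ p ∣ (n≤1+n ∣ q ∣)))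
∣p∪q∣≤∣p∣+∣q∣ (true ∷ p)  (false ∷ q) = s≤s (∣p∪q∣≤∣p∣+∣q∣ p q)
∣p∪q∣≤∣p∣+∣q∣ (false ∷ p) (true ∷ q)  = ≤-trans (s≤s (∣p∪q∣≤∣p∣+∣q∣ p q)) (≤-reflexive (sym (+-suc ∣ p ∣ ∣ q ∣)))
∣p∪q∣≤∣p∣+∣q∣ (false ∷ p) (false ∷ q) = ∣p∪q∣≤∣p∣+∣q∣ p q

∣p++q∣≡∣p∣+∣q∣ : (p : Subset M) (q : Subset N) → ∣ p ++ q ∣ ≡ ∣ p ∣ + ∣ q ∣
∣p++q∣≡∣p∣+∣q∣ []          q = refl
∣p++q∣≡∣p∣+∣q∣ (true ∷ p)  q = cong suc (∣p++q∣≡∣p∣+∣q∣ p q)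
∣p++q∣≡∣p∣+∣q∣ (false ∷ p) q = ∣p++q∣≡∣p∣+∣q∣ p q

x↑ˡ∈p++q⇒x∈p : {p : Subset M} (q : Subset N) {x : Fin M} → x ↑ˡ N ∈ p ++ q → x ∈ p
x↑ˡ∈p++q⇒x∈p {p = p} q {x} x∈ = lookup⇒[]= x p (trans (sym (lookup-++ˡ p q x)) ([]=⇒lookup x∈))

M↑ʳx∈p++q⇒x∈q : (p : Subset M) {q : Subset N} {x : Fin N} → M ↑ʳ x ∈ p ++ q → x ∈ q
M↑ʳx∈p++q⇒x∈q p {q} {x} x∈ = lookup⇒[]= x q (trans (sym (lookup-++ʳ p q x)) ([]=⇒lookup x∈))

∣⁅x⁆∪⁅y⁆∣≤2 : (x y : Fin N) → ∣ ⁅ x ⁆ ∪ ⁅ y ⁆ ∣ ≤ 2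
∣⁅x⁆∪⁅y⁆∣≤2 x y = ≤-trans (∣p∪q∣≤∣p∣+∣q∣ ⁅ x ⁆ ⁅ y ⁆) (≤-reflexive (cong₂ _+_ (∣⁅x⁆∣≡1 x) (∣⁅x⁆∣≡1 y)))

⋃[_]_ : Subset M → (Fin M → Subset N) → Subset N
⋃[ []        ] A = ∅
⋃[ true ∷ E  ] A = A zero ∪ ⋃[ E ] (A ∘ suc)
⋃[ false ∷ E ] A = ⋃[ E ] (A ∘ suc)

x∈⋃⁺ : {E : Subset M} {A : Fin M → Subset N} {e : Fin M} → e ∈ E → x ∈ A e → x ∈ ⋃[ E ] A
x∈⋃⁺ {E = true ∷ E}  here        x∈A = x∈p∪q⁺ (inj₁ x∈A)
x∈⋃⁺ {E = true ∷ E}  (there e∈E) x∈A = x∈p∪q⁺ (inj₂ (x∈⋃⁺ e∈E x∈A))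
x∈⋃⁺ {E = false ∷ E} (there e∈E) x∈A = x∈⋃⁺ e∈E x∈A

∣⋃∣≤k*∣E∣ : (E : Subset M) {A : Fin M → Subset N} → (∀ e → ∣ A e ∣ ≤ k) → ∣ ⋃[ E ] A ∣ ≤ k * ∣ E ∣
∣⋃∣≤k*∣E∣ {N = N} [] _ = ≤-trans (≤-reflexive (∣⊥∣≡0 N)) z≤n
∣⋃∣≤k*∣E∣ {k = k} (true ∷ E) {A} ∣A∣≤k = begin
  ∣ A zero ∪ ⋃[ E ] (A ∘ suc) ∣       ≤⟨ ∣p∪q∣≤∣p∣+∣q∣ (A zero) _ ⟩
  ∣ A zero ∣ + ∣ ⋃[ E ] (A ∘ suc) ∣   ≤⟨ +-mono-≤ (∣A∣≤k zero) (∣⋃∣≤k*∣E∣ E (∣A∣≤k ∘ suc)) ⟩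
  k + k * ∣ E ∣                       ≡⟨ *-suc k ∣ E ∣ ⟨
  k * suc ∣ E ∣                       ∎
  where open ≤-Reasoning
∣⋃∣≤k*∣E∣ (false ∷ E) ∣A∣≤k = ∣⋃∣≤k*∣E∣ E (∣A∣≤k ∘ suc)

∈boundary⁺ : v ∉ S → u ∈ S → a u v ≡ true → v ∈ boundary a S
∈boundary⁺ {N} {v} {S} {u} {a} v∉S u∈S uv = lookup⇒[]= v _ (begin
  lookup (boundary a S) v                                          ≡⟨ lookup∘tabulate _ v ⟩
  not (lookup S v) ∧ any (λ u → lookup S u ∧ a u v) (allFin N)     ≡⟨ cong₂ _∧_ (cong not S∌v) has-S-neighbour ⟩
  true                                                             ∎)
  where
  open ≡-Reasoning
  S∌v : lookup S v ≡ false
  S∌v = ¬-not (v∉S ∘ lookup⇒[]= v S)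
  has-S-neighbour : any (λ u → lookup S u ∧ a u v) (allFin N) ≡ true
  has-S-neighbour = to T-≡ (any⁺ _ (tabulate⁺ u (from T-≡ (cong₂ _∧_ ([]=⇒lookup u∈S) uv))))

∈boundary⁻ : v ∈ boundary a S → v ∉ S × ∃ λ u → u ∈ S × a u v ≡ true
∈boundary⁻ {N} {v} {a} {S} v∈B
  with not-in , adjacent ← to T-∧ (from T-≡ (trans (sym (lookup∘tabulate _ v)) ([]=⇒lookup v∈B)))
  with u , Su∧uv ← satisfied (any⁻ _ (allFin N) adjacent)
  with Su , uv ← to T-∧ Su∧uv
  = (λ v∈S → subst (T ∘ not) ([]=⇒lookup v∈S) not-in) , u , lookup⇒[]= u S (to T-≡ Su) , to T-≡ uv

∣boundary∣+∣S∣≤N : (S : Subset N) → ∣ boundary a S ∣ + ∣ S ∣ ≤ N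
∣boundary∣+∣S∣≤N {N} {a} S = begin
  ∣ boundary a S ∣ + ∣ S ∣ ≤⟨ +-monoˡ-≤ ∣ S ∣ (p⊆q⇒∣p∣≤∣q∣ B⊆∁S) ⟩
  ∣ ∁ S ∣ + ∣ S ∣          ≡⟨ cong (_+ ∣ S ∣) (∣∁p∣≡n∸∣p∣ S) ⟩
  (N ∸ ∣ S ∣) + ∣ S ∣      ≡⟨ m∸n+n≡m (∣p∣≤n S) ⟩
  N                        ∎
  where
  open ≤-Reasoning
  B⊆∁S : boundary a S ⊆ ∁ S
  B⊆∁S v∈B = x∉p⇒x∈∁p (proj₁ (∈boundary⁻ v∈B))

m-n≤p-q⇒m+q≤p+n : ∀ {m n p q} → ℤ.+ m ℤ.- ℤ.+ n ≤ℤ ℤ.+ p ℤ.- ℤ.+ q → m + q ≤ p + n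
m-n≤p-q⇒m+q≤p+n {m} {n} {p} {q} m-n≤p-q = ℤ.drop‿+≤+ (subst₂ _≤ℤ_
  (cancelˡ (ℤ.+ m) (ℤ.+ n) (ℤ.+ q)) (cancelʳ (ℤ.+ p) (ℤ.+ q) (ℤ.+ n))
  (ℤ.+-monoˡ-≤ (ℤ.+ n ℤ.+ ℤ.+ q) m-n≤p-q))
  where
  cancelˡ : ∀ i j k → (i ℤ.- j) ℤ.+ (j ℤ.+ k) ≡ i ℤ.+ k
  cancelˡ = ℤ.solve-∀
  cancelʳ : ∀ i j k → (i ℤ.- j) ℤ.+ (k ℤ.+ j) ≡ i ℤ.+ k
  cancelʳ = ℤ.solve-∀

differential-maximal : IsDifferentialSet a S → (T : Subset N) →
  ∣ boundary a T ∣ + ∣ S ∣ ≤ ∣ boundary a S ∣ + ∣ T ∣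
differential-maximal {a = a} {S} S-diff T =
  m-n≤p-q⇒m+q≤p+n {∣ boundary a T ∣} {∣ T ∣} {∣ boundary a S ∣} {∣ S ∣} (S-diff T)

Undominated : (Fin N → Fin N → Bool) → Subset N → Fin N → Set
Undominated a S v = v ∉ S × v ∉ boundary a S

-- S ∪ ⁅ w ⁆ has at most one element more than S, while its boundary keeps all of B S (as
-- w ∉ B S) and gains v₁ and v₂.
differential⇒¬undominated-fork : IsDifferentialSet a S → {w v₁ v₂ : Fin N} →
  w ∉ boundary a S → Undominated a S v₁ → Undominated a S v₂ →
  a w v₁ ≡ true → a w v₂ ≡ true → v₁ ≢ v₂ → w ≢ v₁ → w ≢ v₂ → ⊥
differential⇒¬undominated-fork {N} {a} {S} S-diff {w} {v₁} {v₂}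
  w∉BS (v₁∉S , v₁∉BS) (v₂∉S , v₂∉BS) wv₁ wv₂ v₁≢v₂ w≢v₁ w≢v₂ =
  <-irrefl refl (begin
    2 + ∣ B S ∣ + ∣ S ∣     ≤⟨ +-monoˡ-≤ ∣ S ∣ gain ⟩
    ∣ B S′ ∣ + ∣ S ∣        ≤⟨ differential-maximal {S = S} S-diff S′ ⟩
    ∣ B S ∣ + ∣ S′ ∣        ≤⟨ +-monoʳ-≤ ∣ B S ∣ ∣S′∣≤1+∣S∣ ⟩
    ∣ B S ∣ + suc ∣ S ∣     ≡⟨ +-suc ∣ B S ∣ ∣ S ∣ ⟩
    suc (∣ B S ∣ + ∣ S ∣)   ∎)
  where
  open ≤-Reasoning
  B : Subset N → Subset N
  B = boundary a
  S′ : Subset N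
  S′ = S ∪ ⁅ w ⁆

  ∣S′∣≤1+∣S∣ : ∣ S′ ∣ ≤ suc ∣ S ∣
  ∣S′∣≤1+∣S∣ = ≤-trans (∣p∪q∣≤∣p∣+∣q∣ S ⁅ w ⁆)
    (≤-reflexive (trans (cong (∣ S ∣ +_) (∣⁅x⁆∣≡1 w)) (+-comm ∣ S ∣ 1)))

  ∉S′ : x ∉ S → w ≢ x → x ∉ S′
  ∉S′ x∉S w≢x x∈S′ with x∈p∪q⁻ S ⁅ w ⁆ x∈S′
  ... | inj₁ x∈S   = x∉S x∈S
  ... | inj₂ x∈⁅w⁆ = w≢x (sym (x∈⁅y⁆⇒x≡y w x∈⁅w⁆))

  BS⊆BS′ : B S ⊆ B S′
  BS⊆BS′ x∈BS with x∉S , u , u∈S , ux ← ∈boundary⁻ x∈BS =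
    ∈boundary⁺ (∉S′ x∉S λ { refl → w∉BS x∈BS }) (p⊆p∪q ⁅ w ⁆ u∈S) ux

  ∈BS′ : x ∉ S → w ≢ x → a w x ≡ true → x ∈ B S′
  ∈BS′ x∉S w≢x wx = ∈boundary⁺ (∉S′ x∉S w≢x) (x∈p∪q⁺ (inj₂ (x∈⁅x⁆ w))) wx

  BS∪v₁⊆BS′ : B S ∪ ⁅ v₁ ⁆ ⊆ B S′
  BS∪v₁⊆BS′ x∈ with x∈p∪q⁻ (B S) ⁅ v₁ ⁆ x∈
  ... | inj₁ x∈BS   = BS⊆BS′ x∈BS
  ... | inj₂ x∈⁅v₁⁆ rewrite x∈⁅y⁆⇒x≡y v₁ x∈⁅v₁⁆ = ∈BS′ v₁∉S w≢v₁ wv₁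

  v₂∉BS∪v₁ : v₂ ∉ B S ∪ ⁅ v₁ ⁆
  v₂∉BS∪v₁ v₂∈ with x∈p∪q⁻ (B S) ⁅ v₁ ⁆ v₂∈
  ... | inj₁ v₂∈BS   = v₂∉BS v₂∈BS
  ... | inj₂ v₂∈⁅v₁⁆ = v₁≢v₂ (sym (x∈⁅y⁆⇒x≡y v₁ v₂∈⁅v₁⁆))

  gain : 2 + ∣ B S ∣ ≤ ∣ B S′ ∣
  gain = ≤-trans
    (s≤s (p⊂q⇒∣p∣<∣q∣ (p⊆p∪q ⁅ v₁ ⁆ , v₁ , x∈p∪q⁺ (inj₂ (x∈⁅x⁆ v₁)) , v₁∉BS)))
    (p⊂q⇒∣p∣<∣q∣ (BS∪v₁⊆BS′ , v₂ , ∈BS′ v₂∉S w≢v₂ wv₂ , v₂∉BS∪v₁))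

differential-covering-bound : IsDifferentialSet a X → (D C : Subset N) →
  (∀ v → v ∈ D ∪ boundary a D ∪ C) → 2 * ∣ X ∣ ≤ 2 * ∣ D ∣ + ∣ C ∣
differential-covering-bound {N} {a} {X} X-diff D C covers = +-cancelˡ-≤ ∣ B D ∣ _ _ (begin
  ∣ B D ∣ + 2 * ∣ X ∣                ≡⟨ double (∣ B D ∣) (∣ X ∣) ⟩
  (∣ B D ∣ + ∣ X ∣) + ∣ X ∣          ≤⟨ +-monoˡ-≤ ∣ X ∣ (differential-maximal {S = X} X-diff D) ⟩
  (∣ B X ∣ + ∣ D ∣) + ∣ X ∣          ≡⟨ swap (∣ B X ∣) (∣ D ∣) (∣ X ∣) ⟩
  (∣ B X ∣ + ∣ X ∣) + ∣ D ∣          ≤⟨ +-monoˡ-≤ ∣ D ∣ (∣boundary∣+∣S∣≤N X) ⟩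
  N + ∣ D ∣                          ≤⟨ +-monoˡ-≤ ∣ D ∣ N≤∣D∣+∣BD∣+∣C∣ ⟩
  ∣ D ∣ + (∣ B D ∣ + ∣ C ∣) + ∣ D ∣  ≡⟨ collect (∣ D ∣) (∣ B D ∣) (∣ C ∣) ⟩
  ∣ B D ∣ + (2 * ∣ D ∣ + ∣ C ∣)      ∎)
  where
  open ≤-Reasoning
  B : Subset N → Subset N
  B = boundary a

  ⊤⊆cover : ⊤ ⊆ D ∪ B D ∪ C
  ⊤⊆cover {v} _ = covers v

  N≤∣D∣+∣BD∣+∣C∣ : N ≤ ∣ D ∣ + (∣ B D ∣ + ∣ C ∣)
  N≤∣D∣+∣BD∣+∣C∣ = begin
    N                          ≡⟨ ∣⊤∣≡n N ⟨
    ∣ ⊤ {N} ∣                  ≤⟨ p⊆q⇒∣p∣≤∣q∣ ⊤⊆cover ⟩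
    ∣ D ∪ B D ∪ C ∣            ≤⟨ ∣p∪q∣≤∣p∣+∣q∣ D (B D ∪ C) ⟩
    ∣ D ∣ + ∣ B D ∪ C ∣        ≤⟨ +-monoʳ-≤ ∣ D ∣ (∣p∪q∣≤∣p∣+∣q∣ (B D) C) ⟩
    ∣ D ∣ + (∣ B D ∣ + ∣ C ∣)  ∎

  double : ∀ m n → m + 2 * n ≡ (m + n) + n
  double = ℕ.solve-∀
  swap : ∀ m n o → (m + n) + o ≡ (m + o) + n
  swap = ℕ.solve-∀
  collect : ∀ m n o → m + (n + o) + m ≡ n + (2 * m + o)
  collect = ℕ.solve-∀

two-distinct-members : {A : Set} {xs : List A} → Unique xs → 2 ≤ length xs →
  ∃₂ λ x y → x ≢ y × x List.∈ xs × y List.∈ xs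
two-distinct-members {xs = x ∷ y ∷ _} ((x≢y ∷ _) ∷ _) _       = x , y , x≢y , here refl , there (here refl)
two-distinct-members {xs = _ ∷ []}    _                 (s≤s ())

two-neighbours : ∀ {n} (G : SimpleGraph n) {w : Fin n} → 2 ≤ degree G w →
  ∃₂ λ u₁ u₂ → u₁ ≢ u₂ × adj G w u₁ ≡ true × adj G w u₂ ≡ true
two-neighbours {n} G {w} 2≤deg
  with u₁ , u₂ , u₁≢u₂ , u₁∈ , u₂∈ ←
         two-distinct-members (Unique.filter⁺ (T? ∘ adj G w) {allFin n} (Unique.allFin⁺ n)) 2≤deg
  = u₁ , u₂ , u₁≢u₂ , neighbour u₁∈ , neighbour u₂∈
  where
  neighbour : ∀ {u} → u List.∈ filterᵇ (adj G w) (allFin n) → adj G w u ≡ true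
  neighbour u∈ = to T-≡ (proj₂ (∈-filter⁻ (T? ∘ adj G w) {xs = allFin n} u∈))

==⇒≡ : {x y : Fin N} → T (x == y) → x ≡ y
==⇒≡ x==y = toℕ-injective (≡ᵇ⇒≡ _ _ x==y)

≡⇒== : {x y : Fin N} → x ≡ y → T (x == y)
≡⇒== {x = x} refl = ≡⇒≡ᵇ (toℕ x) (toℕ x) refl

module _ {n : ℕ} (G : SimpleGraph n) where

  private
    m : ℕ
    m = length (edges G)

  ends : Fin m → Subset n
  ends e = ⁅ proj₁ (List.lookup (edges G) e) ⁆ ∪ ⁅ proj₂ (List.lookup (edges G) e) ⁆

  ∣ends∣≤2 : ∀ e → ∣ ends e ∣ ≤ 2
  ∣ends∣≤2 e = ∣⁅x⁆∪⁅y⁆∣≤2 (proj₁ (List.lookup (edges G) e)) (proj₂ (List.lookup (edges G) e))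

  loopless : ∀ {x y} → adj G x y ≡ true → x ≢ y
  loopless {x} xy refl with () ← trans (sym xy) (irrefl G x)

  edge-index : ∀ {x y} → toℕ x < toℕ y → adj G x y ≡ true → ∃ λ e → List.lookup (edges G) e ≡ (x , y)
  edge-index {x} {y} x<y xy = index xy∈edges , sym (lookup-index xy∈edges)
    where
    xy∈edges : (x , y) List.∈ edges G
    xy∈edges = ∈-filter⁺ (T? ∘ _) (∈-cartesianProduct⁺ (∈-allFin x) (∈-allFin y))
      (from T-∧ (<⇒<ᵇ x<y , from T-≡ xy))

  ∃-edge-joining : ∀ {x y} → adj G x y ≡ true → ∃ λ e → ends e ≡ ⁅ x ⁆ ∪ ⁅ y ⁆
  ∃-edge-joining {x} {y} xy with <-cmp (toℕ x) (toℕ y)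
  ... | tri< x<y _ _ = let e , e=xy = edge-index x<y xy in
    e , cong (λ p → ⁅ proj₁ p ⁆ ∪ ⁅ proj₂ p ⁆) e=xy
  ... | tri≈ _ x=y _ = ⊥-elim (loopless xy (toℕ-injective x=y))
  ... | tri> _ _ y<x = let e , e=yx = edge-index y<x (trans (SimpleGraph.sym G y x) xy) in
    e , trans (cong (λ p → ⁅ proj₁ p ⁆ ∪ ⁅ proj₂ p ⁆) e=yx) (∪-comm ⁅ y ⁆ ⁅ x ⁆)

  joins-injective : ∀ {e w u₁ u₂} → ends e ≡ ⁅ w ⁆ ∪ ⁅ u₁ ⁆ → ends e ≡ ⁅ w ⁆ ∪ ⁅ u₂ ⁆ →
    adj G w u₁ ≡ true → u₁ ≡ u₂
  joins-injective {w = w} {u₁} {u₂} e=wu₁ e=wu₂ wu₁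
    with x∈p∪q⁻ ⁅ w ⁆ ⁅ u₂ ⁆ (subst (u₁ ∈_) (trans (sym e=wu₁) e=wu₂) (x∈p∪q⁺ (inj₂ (x∈⁅x⁆ u₁))))
  ... | inj₁ u₁∈⁅w⁆  = ⊥-elim (loopless wu₁ (sym (x∈⁅y⁆⇒x≡y w u₁∈⁅w⁆)))
  ... | inj₂ u₁∈⁅u₂⁆ = x∈⁅y⁆⇒x≡y u₂ u₁∈⁅u₂⁆

  joining⇒∈ends : ∀ {e x y} → ends e ≡ ⁅ x ⁆ ∪ ⁅ y ⁆ → x ∈ ends e
  joining⇒∈ends {x = x} e=xy = subst (x ∈_) (sym e=xy) (x∈p∪q⁺ (inj₁ (x∈⁅x⁆ x)))

  vertex : Fin n → Fin (orderR G)
  vertex x = x ↑ˡ m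

  edgeVertex : Fin m → Fin (orderR G)
  edgeVertex e = n ↑ʳ e

  data VertexOfR : Fin (orderR G) → Set where
    vertex-of-G    : ∀ x → VertexOfR (vertex x)
    vertex-of-edge : ∀ e → VertexOfR (edgeVertex e)

  classify : ∀ v → VertexOfR v
  classify v with splitAt n v in eq
  ... | inj₁ x = subst VertexOfR (splitAt⁻¹-↑ˡ eq) (vertex-of-G x)
  ... | inj₂ e = subst VertexOfR (splitAt⁻¹-↑ʳ eq) (vertex-of-edge e)

  vertex≢edgeVertex : ∀ {x e} → vertex x ≢ edgeVertex e
  vertex≢edgeVertex {x} {e} x=e
    with () ← trans (sym (splitAt-↑ˡ n x m)) (trans (cong (splitAt n) x=e) (splitAt-↑ʳ n m e))

  adjR-vertex-vertex : ∀ x y → adjR G (vertex x) (vertex y) ≡ adj G x y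
  adjR-vertex-vertex x y rewrite splitAt-↑ˡ n x m | splitAt-↑ˡ n y m = refl

  adjR-edge-edge : ∀ e f → adjR G (edgeVertex e) (edgeVertex f) ≡ false
  adjR-edge-edge e f rewrite splitAt-↑ʳ n m e | splitAt-↑ʳ n m f = refl

  adjR-edge-vertex : ∀ e x → adjR G (edgeVertex e) (vertex x) ≡ adjR G (vertex x) (edgeVertex e)
  adjR-edge-vertex e x rewrite splitAt-↑ˡ n x m | splitAt-↑ʳ n m e = refl

  adjR-vertex-edge : ∀ {x e} → adjR G (vertex x) (edgeVertex e) ≡ true ⇔ x ∈ ends e
  adjR-vertex-edge {x} {e} rewrite splitAt-↑ˡ n x m | splitAt-↑ʳ n m e = mk⇔
    (λ x~e → x∈p∪q⁺ (Sum.map (from x∈⁅y⁆⇔x≡y ∘ ==⇒≡) (from x∈⁅y⁆⇔x≡y ∘ ==⇒≡) (to T-∨ (from T-≡ x~e))))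
    (λ x∈e → to T-≡ (from T-∨ (Sum.map (≡⇒== ∘ to x∈⁅y⁆⇔x≡y) (≡⇒== ∘ to x∈⁅y⁆⇔x≡y) (x∈p∪q⁻ _ _ x∈e))))

  module _ {D : Subset n} {E : Subset m} {w : Fin n} (w∉D : w ∉ D)
           (w∉BD : w ∉ boundary (adj G) D) (w∉⋃ends : w ∉ ⋃[ E ] ends) where

    private
      neighbour∉D : ∀ {u} → adj G u w ≡ true → u ∉ D
      neighbour∉D uw u∈D = w∉BD (∈boundary⁺ w∉D u∈D uw)

      ∉E : ∀ {e} → w ∈ ends e → e ∉ E
      ∉E w∈e e∈E = w∉⋃ends (x∈⋃⁺ e∈E w∈e)

      no-neighbour-of-vertex : ∀ {v} → VertexOfR v → v ∈ D ++ E → adjR G v (vertex w) ≡ true → ⊥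
      no-neighbour-of-vertex (vertex-of-G x) x∈Y xw =
        neighbour∉D (trans (sym (adjR-vertex-vertex x w)) xw) (x↑ˡ∈p++q⇒x∈p E x∈Y)
      no-neighbour-of-vertex (vertex-of-edge e) e∈Y ew =
        ∉E (to adjR-vertex-edge (trans (sym (adjR-edge-vertex e w)) ew)) (M↑ʳx∈p++q⇒x∈q D e∈Y)

      no-neighbour-of-edge : ∀ {e u v} → ends e ≡ ⁅ w ⁆ ∪ ⁅ u ⁆ → adj G w u ≡ true →
        VertexOfR v → v ∈ D ++ E → adjR G v (edgeVertex e) ≡ true → ⊥
      no-neighbour-of-edge {e} {u} e=wu wu (vertex-of-G x) x∈Y xe
        with x∈p∪q⁻ ⁅ w ⁆ ⁅ u ⁆ (subst (x ∈_) e=wu (to adjR-vertex-edge xe))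
      ... | inj₁ x∈⁅w⁆ rewrite x∈⁅y⁆⇒x≡y w x∈⁅w⁆ = w∉D (x↑ˡ∈p++q⇒x∈p E x∈Y)
      ... | inj₂ x∈⁅u⁆ rewrite x∈⁅y⁆⇒x≡y u x∈⁅u⁆ =
        neighbour∉D (trans (SimpleGraph.sym G u w) wu) (x↑ˡ∈p++q⇒x∈p E x∈Y)
      no-neighbour-of-edge {e} _ _ (vertex-of-edge f) _ fe with () ← trans (sym fe) (adjR-edge-edge f e)

    vertex∉boundaryR : vertex w ∉ boundary (adjR G) (D ++ E)
    vertex∉boundaryR w∈B with _ , v , v∈Y , vw ← ∈boundary⁻ w∈B = no-neighbour-of-vertex (classify v) v∈Y vw

    edgeVertex-undominated : ∀ {e u} → ends e ≡ ⁅ w ⁆ ∪ ⁅ u ⁆ → adj G w u ≡ true →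
      Undominated (adjR G) (D ++ E) (edgeVertex e)
    edgeVertex-undominated {e} e=wu wu =
      ∉E (joining⇒∈ends e=wu) ∘ M↑ʳx∈p++q⇒x∈q D ,
      λ e∈B → let _ , v , v∈Y , ve = ∈boundary⁻ e∈B in no-neighbour-of-edge e=wu wu (classify v) v∈Y ve

  ¬undominated-vertex : MinDegreeAtLeast 2 G → {D : Subset n} {E : Subset m} →
    IsDifferentialSet (adjR G) (D ++ E) → ∀ {w} →
    w ∉ D → w ∉ boundary (adj G) D → w ∉ ⋃[ E ] ends → ⊥
  ¬undominated-vertex δ≥2 Y-diff {w} w∉D w∉BD w∉⋃ends
    with u₁ , u₂ , u₁≢u₂ , wu₁ , wu₂ ← two-neighbours G (δ≥2 w)
    with e₁ , e₁=wu₁ ← ∃-edge-joining wu₁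
    with e₂ , e₂=wu₂ ← ∃-edge-joining wu₂
    = differential⇒¬undominated-fork Y-diff (vertex∉boundaryR w∉D w∉BD w∉⋃ends)
        (edgeVertex-undominated w∉D w∉BD w∉⋃ends e₁=wu₁ wu₁)
        (edgeVertex-undominated w∉D w∉BD w∉⋃ends e₂=wu₂ wu₂)
        (from adjR-vertex-edge (joining⇒∈ends e₁=wu₁)) (from adjR-vertex-edge (joining⇒∈ends e₂=wu₂))
        e₁≢e₂ vertex≢edgeVertex vertex≢edgeVertex
    where
    e₁≢e₂ : edgeVertex e₁ ≢ edgeVertex e₂
    e₁≢e₂ e₁=e₂ with refl ← ↑ʳ-injective n e₁ e₂ e₁=e₂ = u₁≢u₂ (joins-injective e₁=wu₁ e₂=wu₂ wu₁)

  differential⇒covering : MinDegreeAtLeast 2 G → {D : Subset n} {E : Subset m} →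
    IsDifferentialSet (adjR G) (D ++ E) → ∀ w → w ∈ D ∪ boundary (adj G) D ∪ ⋃[ E ] ends
  differential⇒covering δ≥2 {D} {E} Y-diff w
    with w ∈? D | w ∈? boundary (adj G) D | w ∈? ⋃[ E ] ends
  ... | yes w∈D | _        | _         = x∈p∪q⁺ (inj₁ w∈D)
  ... | no _    | yes w∈BD | _         = x∈p∪q⁺ (inj₂ (x∈p∪q⁺ (inj₁ w∈BD)))
  ... | no _    | no _     | yes w∈⋃   = x∈p∪q⁺ (inj₂ (x∈p∪q⁺ (inj₂ w∈⋃)))
  ... | no w∉D  | no w∉BD  | no w∉⋃    = ⊥-elim (¬undominated-vertex δ≥2 Y-diff w∉D w∉BD w∉⋃)

corollary2p7 : ∀ (n : ℕ) (G : SimpleGraph n) → 3 ≤ n → Connected G → MinDegreeAtLeast 2 G →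
    (X : Subset n) → IsDifferentialSet (adj G) X →
    (Y : Subset (orderR G)) → IsDifferentialSet (adjR G) Y →
    ∣ X ∣ ≤ ∣ Y ∣
corollary2p7 n G _ _ δ≥2 X X-diff Y Y-diff with D , E , refl ← Vec.splitAt n Y =
  *-cancelˡ-≤ 2 (begin
    2 * ∣ X ∣                      ≤⟨ differential-covering-bound {X = X} X-diff D (⋃[ E ] ends G)
                                        (differential⇒covering G δ≥2 Y-diff) ⟩
    2 * ∣ D ∣ + ∣ ⋃[ E ] ends G ∣   ≤⟨ +-monoʳ-≤ (2 * ∣ D ∣) (∣⋃∣≤k*∣E∣ E (∣ends∣≤2 G)) ⟩
    2 * ∣ D ∣ + 2 * ∣ E ∣           ≡⟨ *-distribˡ-+ 2 ∣ D ∣ ∣ E ∣ ⟨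
    2 * (∣ D ∣ + ∣ E ∣)             ≡⟨ cong (2 *_) (∣p++q∣≡∣p∣+∣q∣ D E) ⟨
    2 * ∣ D ++ E ∣                  ∎)
  where open ≤-Reasoning
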